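{- For a positive integer $k$, let $m_k$ be the minimum order of a connected graph $G$ with $c(G)\geq k$; for a positive integer $n$ let $f_k(n)$ be the number of isomorphism classes of connected graphs $G$ of order $n$ with $c(G)=k$, and let $g(n)$ be the number of isomorphism classes of (not necessarily connected) graphs of order $n$. Then: (1) for all $n>1$, $g(n-1)\leq f_1(n)$; (2) for all $k>1$ and all $n>2m_k$, $g(n-m_k-1)\leq f_k(n)$.
   Context: Cops and Robbers is played on a finite, connected, undirected graph $G$. Cops first each choose a starting vertex, then the robber does; thereafter players alternate rounds, cops first, each player moving to an adjacent vertex or staying put (several cops may share a vertex). The cops win if some cop eventually occupies the robber's vertex. The cop number $c(G)$ is the minimum number of cops that have a winning strategy. -}

module Defs where

open import Data.Nat using (ℕ; zero; suc; _≤_)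
open import Data.Fin using (Fin)
open import Data.Bool using (Bool; true; false)
open import Data.List using (List; []; _∷_)
open import Data.Product using (Σ; ∃; _×_; _,_; proj₁; proj₂)
open import Data.Sum using (_⊎_)
open import Relation.Binary.PropositionalEquality using (_≡_)
open import Function.Bundles using (_↔_; Inverse)

record Graph (n : ℕ) : Set where
  field
    adj     : Fin n → Fin n → Bool
    adj-sym : ∀ i j → adj i j ≡ adj j i
    irrefl  : ∀ i → adj i i ≡ false
open Graph public

_≅_ : ∀ {n} → Graph n → Graph n → Set
_≅_ {n} G H = Σ (Fin n ↔ Fin n) λ π →
  ∀ i j → adj G i j ≡ adj H (Inverse.to π i) (Inverse.to π j)

data Reach {n} (G : Graph n) : Fin n → Fin n → Set where
  here  : ∀ {u} → Reach G u u
  there : ∀ {u w v} → adj G u w ≡ true → Reach G w v → Reach G u v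

Connected : ∀ {n} → Graph n → Set
Connected {n} G = Fin n × (∀ u v → Reach G u v)

Step : ∀ {n} → Graph n → Fin n → Fin n → Set
Step G u v = u ≡ v ⊎ adj G u v ≡ true

State : ℕ → ℕ → Set
State n k = (Fin k → Fin n) × Fin n

cops : ∀ {n k} → State n k → Fin k → Fin n
cops = proj₁

robber : ∀ {n k} → State n k → Fin n
robber = proj₂

Captured : ∀ {n k} → State n k → Set
Captured s = ∃ λ i → cops s i ≡ robber s

-- Strategies may depend on the full history (list of all earlier
-- half-move states, most recent first) and the current state.
record CopStrategy {n} (G : Graph n) (k : ℕ) : Set where
  field
    start : Fin k → Fin n
    move  : List (State n k) → State n k → Fin k → Fin n
    legal : ∀ h s i → Step G (cops s i) (move h s i)

record RobberStrategy {n} (G : Graph n) (k : ℕ) : Set where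
  field
    start : (Fin k → Fin n) → Fin n
    move  : List (State n k) → State n k → Fin n
    legal : ∀ h s → Step G (robber s) (move h s)

module Play {n} {G : Graph n} {k} (σ : CopStrategy G k) (τ : RobberStrategy G k) where
  private
    module σ = CopStrategy σ
    module τ = RobberStrategy τ

  -- round t: state at the start of round t (before the cops' move)
  -- together with the history of all earlier half-move states.
  round : ℕ → State n k × List (State n k)
  round zero = (σ.start , τ.start σ.start) , []
  round (suc t) with round t
  ... | s , p =
    let s′  = σ.move p s , robber s
        s″  = cops s′ , τ.move (s ∷ p) s′
    in s″ , (s′ ∷ s ∷ p)

  mid : ℕ → State n k
  mid t = CopStrategy.move σ (proj₂ (round t)) (proj₁ (round t)) , robber (proj₁ (round t))

  CopsCapture : Set
  CopsCapture = ∃ λ t → Captured (proj₁ (round t)) ⊎ Captured (mid t)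

CopsWin : ∀ {n} → Graph n → ℕ → Set
CopsWin G k = Σ (CopStrategy G k) λ σ → ∀ (τ : RobberStrategy G k) → Play.CopsCapture σ τ

CopNumber : ∀ {n} → Graph n → ℕ → Set
CopNumber G c = CopsWin G c × (∀ j → CopsWin G j → c ≤ j)

CopNumber≥ : ∀ {n} → Graph n → ℕ → Set
CopNumber≥ G k = ∃ λ c → CopNumber G c × k ≤ c

IsMinOrder : ℕ → ℕ → Set
IsMinOrder k m =
  (Σ (Graph m) λ G → Connected G × CopNumber≥ G k) ×
  (∀ m′ (G : Graph m′) → Connected G → CopNumber≥ G k → m ≤ m′)

IsoClassCount : (n : ℕ) → (Graph n → Set) → ℕ → Set
IsoClassCount n P N =
  Σ (Fin N → Graph n) λ r →
    (∀ i → P (r i)) ×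
    (∀ i j → r i ≅ r j → i ≡ j) ×
    (∀ G → P G → ∃ λ i → G ≅ r i)

-- Both bounds come from maps on graphs that are injective on isomorphism classes.  For (1), the
-- cone over a graph H of order n − 1 (a new vertex joined to everything) is connected and cop-win,
-- and H is determined by its cone.  For (2), take a connected graph G of order m = m_k with
-- c(G) ≥ k.  Deleting a non-cut vertex leaves a connected graph of smaller order, which therefore
-- needs fewer than k cops; one more cop guarding the deleted vertex wins on G, so c(G) = k.  Attach
-- the cone over H (of order h = n − m − 1 ≥ m) to a vertex g of G by joining every cone vertex to g.
-- Collapsing the cone onto g is compatible with the game in both directions, so the cop number
-- stays k; and since h ≥ m the cone vertices are recognisable by their degrees, so H is determined
-- by the glued graph.
module Submission where

open import Defs

open import Data.Bool using (Bool; true; false; if_then_else_)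
import Data.Bool.Properties as Bool
open import Data.Empty using (⊥-elim)
open import Data.Fin using (Fin; zero; suc; _≟_; punchIn; punchOut; _↑ˡ_; _↑ʳ_; splitAt)
open import Data.Fin.Permutation
  using (Permutation; _⟨$⟩ʳ_; _⟨$⟩ˡ_; _∘ₚ_; flip; remove; transpose; inverseʳ; inverseˡ; punchIn-permute)
import Data.Fin.Permutation.Components as Components
open import Data.Fin.Properties
  using (any?; injective⇒≤; splitAt-↑ˡ; splitAt-↑ʳ; join-splitAt; punchIn-punchOut; punchIn-injective; punchInᵢ≢i)
open import Data.List using (List; []; _∷_; map; length; allFin)
open import Data.List.Extrema.Nat using (argmax; f[xs]≤f[argmax])
open import Data.List.Membership.Propositional.Properties using (∈-allFin)
open import Data.List.Properties using (∷-injective; ∷-injectiveˡ)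
import Data.List.Relation.Unary.All as All
open import Data.Nat using (ℕ; zero; suc; 2+; _+_; _*_; _∸_; _≤_; _<_; _≤?_; z≤n; s≤s; ⌊_/2⌋; ⌈_/2⌉)
open import Data.Nat.Induction using (<-rec)
import Data.Nat.Properties
open import Data.Nat.Properties
  using ( ≤-refl; ≤-reflexive; ≤-trans; ≤-antisym; <-≤-trans; <-irrefl; ≮⇒≥; ≰⇒>; 1+n≰n; n≤0⇒n≡0
        ; m≤m+n; m≤n+m; +-mono-≤; +-assoc; +-suc; +-identityʳ; m+n∸m≡n; m≤n⇒∃[o]m+o≡n; n≡⌊n+n/2⌋
        ; anyUpTo?)
open import Algebra.Properties.CommutativeMonoid.Sum Data.Nat.Properties.+-0-commutativeMonoid
  using (sum; ∑-permute; sum-cong-≗)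
open import Data.Product using (∃; _×_; _,_; proj₁; proj₂)
import Data.Sum as Sum
open import Data.Sum using (_⊎_; inj₁; inj₂; [_,_]; [_,_]′)
open import Data.Unit using (⊤)
open import Function using (id; const)
open import Function.Bundles using (mk↔ₛ′)
open import Relation.Binary.PropositionalEquality hiding ([_])
open import Relation.Nullary using (¬_; Dec; yes; no; does; contradiction)
open import Relation.Nullary.Decidable
  using (decidable-stable; dec-true; dec-false; _×-dec_; _⊎-dec_; ¬¬-excluded-middle)
open import Relation.Unary using (Decidable)

Least : (ℕ → Set) → ℕ → Set
Least P t = P t × (∀ s → P s → t ≤ s)

least : ∀ {P : ℕ → Set} → Decidable P → ∀ {t} → P t → ∃ (Least P)
least {P} P? {t} = <-rec (λ t → P t → ∃ (Least P)) search t
  where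
  search : ∀ t → (∀ {s} → s < t → P s → ∃ (Least P)) → P t → ∃ (Least P)
  search t smaller pt with anyUpTo? P? t
  ... | yes (s , s<t , ps) = smaller s<t ps
  ... | no ¬below = t , pt , λ s ps → ≮⇒≥ λ s<t → ¬below (s , s<t , ps)

¬¬-least : ∀ {P : ℕ → Set} {t} → P t → ¬ ¬ ∃ (Least P)
¬¬-least {P} {t} = <-rec (λ t → P t → ¬ ¬ ∃ (Least P)) search t
  where
  search : ∀ t → (∀ {s} → s < t → P s → ¬ ¬ ∃ (Least P)) → P t → ¬ ¬ ∃ (Least P)
  search t smaller pt k = ¬¬-excluded-middle {A = ∃ λ s → s < t × P s} λ
    { (yes (s , s<t , ps)) → smaller s<t ps k
    ; (no ¬below) → k (t , pt , λ s ps → ≮⇒≥ λ s<t → ¬below (s , s<t , ps)) }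

step? : ∀ {n} (G : Graph n) x y → Dec (Step G x y)
step? G x y = x ≟ y ⊎-dec adj G x y Bool.≟ true

stepTo : ∀ {n} → Graph n → Fin n → Fin n → Fin n
stepTo G x y with step? G x y
... | yes _ = y
... | no _ = x

stepTo-legal : ∀ {n} (G : Graph n) x y → Step G x (stepTo G x y)
stepTo-legal G x y with step? G x y
... | yes s = s
... | no _ = inj₁ refl

stepTo-arrives : ∀ {n} (G : Graph n) {x y} → Step G x y → stepTo G x y ≡ y
stepTo-arrives G {x} {y} s with step? G x y
... | yes _ = refl
... | no ¬s = ⊥-elim (¬s s)

captured? : ∀ {n k} (s : State n k) → Dec (Captured s)
captured? s = any? λ i → cops s i ≟ robber s

Guarded : ∀ {n k} → Graph n → (Fin k → Fin n) → Fin n → Set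
Guarded G c x = ∃ λ i → Step G (c i) x

guarded? : ∀ {n k} (G : Graph n) (c : Fin k → Fin n) x → Dec (Guarded G c x)
guarded? G c x = any? λ i → step? G (c i) x

standStill : ∀ {n} (G : Graph n) {k} → Fin n → RobberStrategy G k
standStill G v = record { start = λ _ → v ; move = λ _ s → robber s ; legal = λ _ _ → inj₁ refl }

noCops-lose : ∀ {n} (G : Graph n) → Fin n → ¬ CopsWin G 0
noCops-lose G v (σ , win) with win (standStill G v)
... | _ , inj₁ (() , _)
... | _ , inj₂ (() , _)

copsWin⇒1≤ : ∀ {n} (G : Graph n) → Fin n → ∀ {k} → CopsWin G k → 1 ≤ k
copsWin⇒1≤ G v {zero} win = ⊥-elim (noCops-lose G v win)
copsWin⇒1≤ G v {suc k} win = s≤s z≤n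

copOnEveryVertex-win : ∀ {n} (G : Graph n) → CopsWin G n
copOnEveryVertex-win G = σ , λ τ → zero , inj₁ (RobberStrategy.start τ (λ i → i) , refl)
  where
  σ : CopStrategy G _
  σ = record { start = λ i → i ; move = λ _ s → cops s ; legal = λ _ _ _ → inj₁ refl }

dominating⇒copsWin : ∀ {n} (G : Graph n) u → (∀ x → Step G u x) → CopsWin G 1
dominating⇒copsWin G u dom = σ , λ τ → zero , inj₂ (zero , stepTo-arrives G (dom _))
  where
  σ : CopStrategy G 1
  σ = record { start = λ _ → u ; move = λ _ s i → stepTo G (cops s i) (robber s) ; legal = λ _ s i → stepTo-legal G _ _ }

-- Isomorphism classes

≅-sym : ∀ {n} {G H : Graph n} → G ≅ H → H ≅ G
≅-sym {H = H} (π , e) = flip π , λ i j →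
  sym (trans (e (flip π ⟨$⟩ʳ i) (flip π ⟨$⟩ʳ j)) (cong₂ (adj H) (inverseʳ π) (inverseʳ π)))

≅-trans : ∀ {n} {G H K : Graph n} → G ≅ H → H ≅ K → G ≅ K
≅-trans (π , e) (ρ , f) = π ∘ₚ ρ , λ i j → trans (e i j) (f _ _)

isoClassCount-≤ : ∀ {h n a b} {P : Graph n → Set} (F : Graph h → Graph n) →
  (∀ H → P (F H)) → (∀ H H′ → F H ≅ F H′ → H ≅ H′) →
  IsoClassCount h (λ _ → ⊤) a → IsoClassCount n P b → a ≤ b
isoClassCount-≤ {a = a} {b} F PF reflects (r , _ , r-distinct , _) (s , _ , _ , s-covers) =
  injective⇒≤ class-injective
  where
  class : Fin a → Fin b
  class i = proj₁ (s-covers (F (r i)) (PF (r i)))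
  in-class : ∀ i → F (r i) ≅ s (class i)
  in-class i = proj₂ (s-covers (F (r i)) (PF (r i)))
  class-injective : ∀ {i i′} → class i ≡ class i′ → i ≡ i′
  class-injective {i} {i′} eq = r-distinct i i′ (reflects (r i) (r i′)
    (≅-trans {G = F (r i)} {s (class i)} {F (r i′)} (in-class i)
      (subst (λ c → s c ≅ F (r i′)) (sym eq) (≅-sym {G = F (r i′)} {s (class i′)} (in-class i′)))))

Universal : ∀ {n} → Graph n → Fin n → Set
Universal G u = ∀ v → v ≢ u → adj G u v ≡ true

≅-universal : ∀ {n} {G H : Graph n} ((π , _) : G ≅ H) {u} → Universal G u → Universal H (π ⟨$⟩ʳ u)
≅-universal {G = G} {H} (π , e) {u} univ v v≢πu = begin
  adj H (π ⟨$⟩ʳ u) v                  ≡⟨ cong (adj H _) (inverseʳ π) ⟨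
  adj H (π ⟨$⟩ʳ u) (π ⟨$⟩ʳ (π ⟨$⟩ˡ v)) ≡⟨ e u (π ⟨$⟩ˡ v) ⟨
  adj G u (π ⟨$⟩ˡ v)                  ≡⟨ univ (π ⟨$⟩ˡ v) π⁻¹v≢u ⟩
  true                                ∎
  where
  open ≡-Reasoning
  π⁻¹v≢u : π ⟨$⟩ˡ v ≢ u
  π⁻¹v≢u eq = v≢πu (trans (sym (inverseʳ π)) (cong (π ⟨$⟩ʳ_) eq))

-- Paths and cones

reach-trans : ∀ {n} {G : Graph n} {a b c} → Reach G a b → Reach G b c → Reach G a c
reach-trans here q = q
reach-trans (there e p) q = there e (reach-trans p q)

reach-sym : ∀ {n} {G : Graph n} {a b} → Reach G a b → Reach G b a
reach-sym here = here
reach-sym {G = G} (there e p) = reach-trans (reach-sym p) (there (trans (adj-sym G _ _) e) here)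

reach-map : ∀ {p q} {S : Graph p} {T : Graph q} (f : Fin p → Fin q) →
  (∀ {a b} → adj S a b ≡ true → Step T (f a) (f b)) → ∀ {a b} → Reach S a b → Reach T (f a) (f b)
reach-map f f-step here = here
reach-map {T = T} f f-step (there e p) with f-step e
... | inj₁ eq = subst (λ z → Reach T z (f _)) (sym eq) (reach-map f f-step p)
... | inj₂ e′ = there e′ (reach-map f f-step p)

cone : ∀ {h} → Graph h → Graph (suc h)
cone {h} H = record { adj = coneAdj ; adj-sym = coneAdj-sym ; irrefl = coneAdj-irrefl }
  where
  coneAdj : Fin (suc h) → Fin (suc h) → Bool
  coneAdj zero zero = false
  coneAdj zero (suc j) = true
  coneAdj (suc i) zero = true
  coneAdj (suc i) (suc j) = adj H i j
  coneAdj-sym : ∀ i j → coneAdj i j ≡ coneAdj j i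
  coneAdj-sym zero zero = refl
  coneAdj-sym zero (suc j) = refl
  coneAdj-sym (suc i) zero = refl
  coneAdj-sym (suc i) (suc j) = adj-sym H i j
  coneAdj-irrefl : ∀ i → coneAdj i i ≡ false
  coneAdj-irrefl zero = refl
  coneAdj-irrefl (suc i) = irrefl H i

cone-apex-step : ∀ {h} (H : Graph h) x → Step (cone H) zero x
cone-apex-step H zero = inj₁ refl
cone-apex-step H (suc x) = inj₂ refl

cone-apex-universal : ∀ {h} (H : Graph h) → Universal (cone H) zero
cone-apex-universal H zero 0≢0 = ⊥-elim (0≢0 refl)
cone-apex-universal H (suc v) _ = refl

cone-connected : ∀ {h} (H : Graph h) → Connected (cone H)
cone-connected H = zero , λ u v → reach-trans (reach-sym (from-apex u)) (from-apex v)
  where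
  from-apex : ∀ u → Reach (cone H) zero u
  from-apex zero = here
  from-apex (suc u) = there refl here

cone-copNumber : ∀ {h} (H : Graph h) → CopNumber (cone H) 1
cone-copNumber H = dominating⇒copsWin (cone H) zero (cone-apex-step H) , λ _ → copsWin⇒1≤ (cone H) zero

transpose-source : ∀ {n} (a b : Fin n) → Components.transpose a b a ≡ b
transpose-source a b with a ≟ a
... | yes _ = refl
... | no a≢a = ⊥-elim (a≢a refl)

transpose-target : ∀ {n} (a b : Fin n) → Components.transpose a b b ≡ a
transpose-target a b with b ≟ a
... | yes b≡a = b≡a
... | no _ with b ≟ b
...   | yes _ = refl
...   | no b≢b = ⊥-elim (b≢b refl)

transpose-other : ∀ {n} {a b z : Fin n} → z ≢ a → z ≢ b → Components.transpose a b z ≡ z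
transpose-other {a = a} {b} {z} z≢a z≢b with z ≟ a
... | yes z≡a = ⊥-elim (z≢a z≡a)
... | no _ with z ≟ b
...   | yes z≡b = ⊥-elim (z≢b z≡b)
...   | no _ = refl

transpose-universal-automorphism : ∀ {n} (G : Graph n) {a b} → Universal G a → Universal G b →
  ∀ x y → adj G (Components.transpose a b x) (Components.transpose a b y) ≡ adj G x y
transpose-universal-automorphism {n} G {a} {b} ua ub x y = cases (x ≟ a) (x ≟ b) (y ≟ a) (y ≟ b)
  where
  t : Fin n → Fin n
  t = Components.transpose a b
  _via_ : ∀ {x′ y′} → t x ≡ x′ × t y ≡ y′ → adj G x′ y′ ≡ adj G x y → adj G (t x) (t y) ≡ adj G x y
  (ex , ey) via e = trans (cong₂ (adj G) ex ey) e
  into : ∀ {u} → Universal G u → ∀ v → v ≢ u → adj G v u ≡ true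
  into univ v v≢u = trans (adj-sym G v _) (univ v v≢u)
  cases : Dec (x ≡ a) → Dec (x ≡ b) → Dec (y ≡ a) → Dec (y ≡ b) → adj G (t x) (t y) ≡ adj G x y
  cases (yes refl) _ (yes refl) _ =
    (transpose-source a b , transpose-source a b) via trans (irrefl G b) (sym (irrefl G a))
  cases (yes refl) _ (no y≢a) (yes refl) =
    (transpose-source a b , transpose-target a b) via trans (ub a (≢-sym y≢a)) (sym (ua b y≢a))
  cases (yes refl) _ (no y≢a) (no y≢b) =
    (transpose-source a b , transpose-other y≢a y≢b) via trans (ub y y≢b) (sym (ua y y≢a))
  cases (no x≢a) (yes refl) (yes refl) _ =
    (transpose-target a b , transpose-source a b) via trans (ua b x≢a) (sym (ub a (≢-sym x≢a)))
  cases (no _) (yes refl) (no _) (yes refl) =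
    (transpose-target a b , transpose-target a b) via trans (irrefl G a) (sym (irrefl G b))
  cases (no _) (yes refl) (no y≢a) (no y≢b) =
    (transpose-target a b , transpose-other y≢a y≢b) via trans (ua y y≢a) (sym (ub y y≢b))
  cases (no x≢a) (no x≢b) (yes refl) _ =
    (transpose-other x≢a x≢b , transpose-source a b) via trans (into ub x x≢b) (sym (into ua x x≢a))
  cases (no x≢a) (no x≢b) (no _) (yes refl) =
    (transpose-other x≢a x≢b , transpose-target a b) via trans (into ua x x≢a) (sym (into ub x x≢b))
  cases (no x≢a) (no x≢b) (no y≢a) (no y≢b) =
    (transpose-other x≢a x≢b , transpose-other y≢a y≢b) via refl

cone-≅-fixing-apex : ∀ {h} {H H′ : Graph h} ((π , _) : cone H ≅ cone H′) → π ⟨$⟩ʳ zero ≡ zero → H ≅ H′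
cone-≅-fixing-apex {H′ = H′} (π , e) fixes = remove zero π , λ i j →
  trans (e (suc i) (suc j)) (cong₂ (adj (cone H′)) (shift i) (shift j))
  where
  shift : ∀ i → π ⟨$⟩ʳ suc i ≡ suc (remove zero π ⟨$⟩ʳ i)
  shift i = trans (punchIn-permute π zero i) (cong (λ z → punchIn z (remove zero π ⟨$⟩ʳ i)) fixes)

-- An isomorphism may send the apex to another universal vertex; composing it with the
-- transposition of the two, an automorphism, makes it fix the apex.
cone-reflects-≅ : ∀ {h} (H H′ : Graph h) → cone H ≅ cone H′ → H ≅ H′
cone-reflects-≅ {h} H H′ iso@(π , e) =
  cone-≅-fixing-apex (π ∘ₚ transpose u zero , e′) (transpose-source u zero)
  where
  u : Fin (suc h)
  u = π ⟨$⟩ʳ zero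
  e′ : ∀ i j → adj (cone H) i j ≡
    adj (cone H′) (Components.transpose u zero (π ⟨$⟩ʳ i)) (Components.transpose u zero (π ⟨$⟩ʳ j))
  e′ i j = trans (e i j) (sym (transpose-universal-automorphism (cone H′)
    (≅-universal {G = cone H} {cone H′} iso (cone-apex-universal H)) (cone-apex-universal H′) (π ⟨$⟩ʳ i) (π ⟨$⟩ʳ j)))

-- Transferring cop strategies

captured-cong : ∀ {n k} {c c′ : Fin k → Fin n} {x} → (∀ i → c i ≡ c′ i) → Captured (c′ , x) → Captured (c , x)
captured-cong c≗c′ (i , caught) = i , trans (c≗c′ i) caught

guarded-cong : ∀ {n k} {G : Graph n} {c c′ : Fin k → Fin n} {x} → (∀ i → c i ≡ c′ i) →
  Guarded G c′ x → Guarded G c x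
guarded-cong {G = G} {x = x} c≗c′ (i , s) = i , subst (λ z → Step G z x) (sym (c≗c′ i)) s

captured⇒guarded : ∀ {n k} {G : Graph n} {c : Fin k → Fin n} {x} → Captured (c , x) → Guarded G c x
captured⇒guarded (i , caught) = i , inj₁ caught

Trapped : ∀ {n k} → Graph n → (Fin k → Fin n) → Fin n → Set
Trapped G c x = Guarded G c x × (∀ y → Step G x y → Captured (c , y) ⊎ Guarded G c y)

-- A history lists, most recent first, pairs (state after the cops' move, state at the start of
-- the round); the robber's positions at the starts of the earlier rounds are read off the latter.
robberTrail : ∀ {n k} → List (State n k) → List (Fin n)
robberTrail (_ ∷ s ∷ h) = robber s ∷ robberTrail h
robberTrail _ = []

-- Against a fixed cop strategy, the robber's positions determine the whole play.
module Replay {n} {G : Graph n} {k} (σ : CopStrategy G k) where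
  private module σ = CopStrategy σ

  replay : Fin n → List (Fin n) → State n k × List (State n k)
  replay x [] = (σ.start , x) , []
  replay x (y ∷ ys) with replay y ys
  ... | s , h = (σ.move h s , x) , ((σ.move h s , robber s) ∷ s ∷ h)

module PlayNotation {n} {G : Graph n} {k} (σ : CopStrategy G k) (τ : RobberStrategy G k) where
  open Play σ τ public

  state : ℕ → State n k
  state t = proj₁ (round t)

  history : ℕ → List (State n k)
  history t = proj₂ (round t)

  copsAt : ℕ → Fin k → Fin n
  copsAt t = cops (state t)

  robberAt : ℕ → Fin n
  robberAt t = robber (state t)

  trail : ℕ → List (Fin n)
  trail t = robberAt t ∷ robberTrail (history t)

  round-replay : ∀ t → round t ≡ Replay.replay σ (robberAt t) (robberTrail (history t))
  round-replay zero = refl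
  round-replay (suc t) rewrite sym (round-replay t) = refl

  history-length : ∀ t → length (history t) ≡ t + t
  history-length zero = refl
  history-length (suc t) = cong suc (trans (cong suc (history-length t)) (sym (+-suc t t)))

-- In round t the robber is handed a history of length 2t + 1.
follow : ∀ {n} (G : Graph n) {k} → (ℕ → Fin n) → RobberStrategy G k
follow G walk = record
  { start = λ _ → walk 0
  ; move = λ h s → stepTo G (robber s) (walk ⌈ length h /2⌉)
  ; legal = λ h s → stepTo-legal G (robber s) _ }

follow-step : ∀ {n} {G : Graph n} {k} (σ : CopStrategy G k) (walk : ℕ → Fin n) →
  let open PlayNotation σ (follow G walk) in
  ∀ t → robberAt t ≡ walk t → Step G (walk t) (walk (suc t)) → robberAt (suc t) ≡ walk (suc t)
follow-step {G = G} σ walk t on-walk step = begin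
  stepTo G (robberAt t) (walk ⌈ suc (length (history t)) /2⌉)
    ≡⟨ cong₂ (λ x m → stepTo G x (walk ⌈ suc m /2⌉)) on-walk (history-length t) ⟩
  stepTo G (walk t) (walk (suc ⌊ t + t /2⌋))
    ≡⟨ cong (λ m → stepTo G (walk t) (walk (suc m))) (n≡⌊n+n/2⌋ t) ⟨
  stepTo G (walk t) (walk (suc t))
    ≡⟨ stepTo-arrives G step ⟩
  walk (suc t) ∎
  where
  open PlayNotation σ (follow G walk)
  open ≡-Reasoning

-- The cops on T play the image under ψ of a strategy on S against the shadow φ of the robber,
-- except that a cop able to reach the robber captures it at once.  While the robber evades, its
-- shadow moves legally in S (φ-legal), and a capture of the shadow is completed within a round
-- (φ-capture).
module Simulation {p q j j′} (S : Graph p) (T : Graph q)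
  (φ : Fin q → Fin p) (ψ : (Fin j → Fin p) → Fin j′ → Fin q)
  (ψ-legal : ∀ {c c′} → (∀ i → Step S (c i) (c′ i)) → ∀ i → Step T (ψ c i) (ψ c′ i))
  (φ-legal : ∀ c c′ {x y} → Step T x y → ¬ Captured (ψ c , x) → ¬ Captured (ψ c′ , y) → Step S (φ x) (φ y))
  (φ-capture : ∀ c x → Captured (c , φ x) → Captured (ψ c , x) ⊎ Trapped T (ψ c) x)
  where

  module _ (σ : CopStrategy S j) where
    private module σ = CopStrategy σ
    open Replay σ

    shadowState : List (State q j′) → State q j′ → State p j × List (State p j)
    shadowState h s = replay (φ (robber s)) (map φ (robberTrail h))

    shadowCops : List (State q j′) → State q j′ → Fin j′ → Fin q
    shadowCops h s = let (s′ , h′) = shadowState h s in ψ (σ.move h′ s′)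

    shadowMove : List (State q j′) → State q j′ → Fin j′ → Fin q
    shadowMove h s i with step? T (cops s i) (robber s)
    ... | yes _ = robber s
    ... | no _ = stepTo T (cops s i) (shadowCops h s i)

    shadowMove-legal : ∀ h s i → Step T (cops s i) (shadowMove h s i)
    shadowMove-legal h s i with step? T (cops s i) (robber s)
    ... | yes step = step
    ... | no _ = stepTo-legal T _ _

    shadowMove-catches : ∀ h s i → Step T (cops s i) (robber s) → shadowMove h s i ≡ robber s
    shadowMove-catches h s i step with step? T (cops s i) (robber s)
    ... | yes _ = refl
    ... | no ¬step = ⊥-elim (¬step step)

    shadowMove-shadows : ∀ h s i → ¬ Step T (cops s i) (robber s) → shadowMove h s i ≡ stepTo T (cops s i) (shadowCops h s i)
    shadowMove-shadows h s i ¬step with step? T (cops s i) (robber s)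
    ... | yes step = ⊥-elim (¬step step)
    ... | no _ = refl

    shadow : CopStrategy T j′
    shadow = record { start = ψ σ.start ; move = shadowMove ; legal = shadowMove-legal }

  module _ (σ : CopStrategy S j) (τ : RobberStrategy T j′) where
    private module τ = RobberStrategy τ
    module PT = PlayNotation (shadow σ) τ

    projectedWalk : ℕ → Fin p
    projectedWalk t = φ (PT.robberAt t)

    module PS = PlayNotation σ (follow S projectedWalk)

    InSync : ℕ → Set
    InSync t = (∀ i → PT.copsAt t i ≡ ψ (PS.copsAt t) i) × PS.trail t ≡ map φ (PT.trail t)

    robber-sync : ∀ t → InSync t → PS.robberAt t ≡ φ (PT.robberAt t)
    robber-sync t (_ , trails) = ∷-injectiveˡ trails

    robber-step : ∀ t → Step T (PT.robberAt t) (PT.robberAt (suc t))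
    robber-step t = τ.legal (PT.state t ∷ PT.history t) (PT.mid t)

    guarded⇒capture : ∀ t → Guarded T (PT.copsAt t) (PT.robberAt t) → PT.CopsCapture
    guarded⇒capture t (i , step) = t , inj₂ (i , shadowMove-catches σ (PT.history t) (PT.state t) i step)

    shadow-replays : ∀ t → InSync t → shadowState σ (PT.history t) (PT.state t) ≡ PS.round t
    shadow-replays t (_ , trails) = begin
      Replay.replay σ (φ (PT.robberAt t)) (map φ (robberTrail (PT.history t)))
        ≡⟨ cong₂ (Replay.replay σ) (proj₁ (∷-injective trails)) (proj₂ (∷-injective trails)) ⟨
      Replay.replay σ (PS.robberAt t) (robberTrail (PS.history t))
        ≡⟨ PS.round-replay t ⟨
      PS.round t ∎
      where open ≡-Reasoning

    cops-sync : ∀ t → InSync t → ¬ Guarded T (PT.copsAt t) (PT.robberAt t) →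
      ∀ i → PT.copsAt (suc t) i ≡ ψ (PS.copsAt (suc t)) i
    cops-sync t sync@(cops≡ , _) unguarded i = begin
      shadowMove σ (PT.history t) (PT.state t) i
        ≡⟨ shadowMove-shadows σ (PT.history t) (PT.state t) i (λ step → unguarded (i , step)) ⟩
      stepTo T (PT.copsAt t i) (shadowCops σ (PT.history t) (PT.state t) i)
        ≡⟨ cong (λ (s′ , h′) → stepTo T (PT.copsAt t i) (ψ (CopStrategy.move σ h′ s′) i)) (shadow-replays t sync) ⟩
      stepTo T (PT.copsAt t i) (ψ (PS.copsAt (suc t)) i)
        ≡⟨ stepTo-arrives T (subst (λ z → Step T z (ψ (PS.copsAt (suc t)) i)) (sym (cops≡ i))
             (ψ-legal (CopStrategy.legal σ (PS.history t) (PS.state t)) i)) ⟩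
      ψ (PS.copsAt (suc t)) i ∎
      where open ≡-Reasoning

    sync-step : ∀ t → InSync t → PT.CopsCapture ⊎ InSync (suc t)
    sync-step t sync with guarded? T (PT.copsAt t) (PT.robberAt t)
    ... | yes guarded = inj₁ (guarded⇒capture t guarded)
    ... | no unguarded with captured? (PT.state (suc t))
    ...   | yes caught = inj₁ (suc t , inj₁ caught)
    ...   | no uncaught = inj₂ (cops≡′ , cong₂ _∷_ robber≡′ (proj₂ sync))
      where
      cops≡′ : ∀ i → PT.copsAt (suc t) i ≡ ψ (PS.copsAt (suc t)) i
      cops≡′ = cops-sync t sync unguarded
      robber≡′ : PS.robberAt (suc t) ≡ φ (PT.robberAt (suc t))
      robber≡′ = follow-step σ projectedWalk t (robber-sync t sync)
        (φ-legal (PS.copsAt t) (PS.copsAt (suc t)) (robber-step t)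
          (λ caught → unguarded (captured⇒guarded {G = T} (captured-cong (proj₁ sync) caught)))
          (λ caught → uncaught (captured-cong cops≡′ caught)))

    in-sync : ∀ t → PT.CopsCapture ⊎ InSync t
    in-sync zero = inj₂ ((λ _ → refl) , refl)
    in-sync (suc t) with in-sync t
    ... | inj₁ capture = inj₁ capture
    ... | inj₂ sync = sync-step t sync

    start-capture-transfers : ∀ t → InSync t → Captured (PS.state t) → PT.CopsCapture
    start-capture-transfers t sync@(cops≡ , _) caught
      with φ-capture (PS.copsAt t) (PT.robberAt t) (subst (λ x → Captured (PS.copsAt t , x)) (robber-sync t sync) caught)
    ... | inj₁ caught′ = t , inj₁ (captured-cong cops≡ caught′)
    ... | inj₂ (guarded , _) = guarded⇒capture t (guarded-cong {G = T} cops≡ guarded)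

    capture-after-cops-move : ∀ t → (∀ i → PT.copsAt (suc t) i ≡ ψ (PS.copsAt (suc t)) i) →
      Captured (ψ (PS.copsAt (suc t)) , PT.robberAt t) ⊎ Trapped T (ψ (PS.copsAt (suc t))) (PT.robberAt t) →
      PT.CopsCapture
    capture-after-cops-move t cops≡ (inj₁ caught) = t , inj₂ (captured-cong cops≡ caught)
    capture-after-cops-move t cops≡ (inj₂ (_ , escapes)) with escapes (PT.robberAt (suc t)) (robber-step t)
    ... | inj₁ caught = suc t , inj₁ (captured-cong cops≡ caught)
    ... | inj₂ guarded = guarded⇒capture (suc t) (guarded-cong {G = T} cops≡ guarded)

    mid-capture-transfers : ∀ t → InSync t → Captured (PS.mid t) → PT.CopsCapture
    mid-capture-transfers t sync caught with guarded? T (PT.copsAt t) (PT.robberAt t)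
    ... | yes guarded = guarded⇒capture t guarded
    ... | no unguarded = capture-after-cops-move t (cops-sync t sync unguarded)
      (φ-capture (PS.copsAt (suc t)) (PT.robberAt t) (subst (λ x → Captured (PS.copsAt (suc t) , x)) (robber-sync t sync) caught))

    capture-transfers : PS.CopsCapture → PT.CopsCapture
    capture-transfers (t , caught) with in-sync t
    ... | inj₁ capture = capture
    ... | inj₂ sync = [ start-capture-transfers t sync , mid-capture-transfers t sync ] caught

  transfer : CopsWin S j → CopsWin T j′
  transfer (σ , win) = shadow σ , λ τ → capture-transfers σ τ (win (follow S (projectedWalk σ τ)))

-- Degrees

boolToℕ : Bool → ℕ
boolToℕ b = if b then 1 else 0

count : ∀ {n} → (Fin n → Bool) → ℕ
count p = sum λ i → boolToℕ (p i)

count-cong : ∀ {n} {p q : Fin n → Bool} → (∀ i → p i ≡ q i) → count p ≡ count q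
count-cong p≗q = sum-cong-≗ λ i → cong boolToℕ (p≗q i)

count-split : ∀ m {n} (p : Fin (m + n) → Bool) → count p ≡ count (λ i → p (i ↑ˡ n)) + count (λ j → p (m ↑ʳ j))
count-split zero p = refl
count-split (suc m) p = trans (cong (boolToℕ (p zero) +_) (count-split m (λ i → p (suc i))))
  (sym (+-assoc (boolToℕ (p zero)) _ _))

count-≤ : ∀ {n} (p : Fin n → Bool) → count p ≤ n
count-≤ {suc n} p with p zero
... | true = s≤s (count-≤ (λ i → p (suc i)))
... | false = ≤-trans (count-≤ (λ i → p (suc i))) (m≤n+m n 1)
count-≤ {zero} p = z≤n

count-<-if-false : ∀ {n} (p : Fin n → Bool) {i} → p i ≡ false → count p < n
count-<-if-false p {zero} pi≡false rewrite pi≡false = s≤s (count-≤ (λ i → p (suc i)))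
count-<-if-false p {suc i} pi≡false with p zero
... | true = s≤s (count-<-if-false (λ i → p (suc i)) pi≡false)
... | false = ≤-trans (count-<-if-false (λ i → p (suc i)) pi≡false) (m≤n+m _ 1)

count-≥1-if-true : ∀ {n} (p : Fin n → Bool) {i} → p i ≡ true → 1 ≤ count p
count-≥1-if-true p {zero} pi≡true rewrite pi≡true = s≤s z≤n
count-≥1-if-true p {suc i} pi≡true =
  ≤-trans (count-≥1-if-true (λ i → p (suc i)) pi≡true) (m≤n+m _ (boolToℕ (p zero)))

count-true : ∀ {n} (p : Fin n → Bool) → (∀ i → p i ≡ true) → count p ≡ n
count-true {zero} p _ = refl
count-true {suc n} p all-true rewrite all-true zero = cong suc (count-true (λ i → p (suc i)) (λ i → all-true (suc i)))

count-false : ∀ {n} (p : Fin n → Bool) → (∀ i → p i ≡ false) → count p ≡ 0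
count-false {zero} p _ = refl
count-false {suc n} p all-false rewrite all-false zero = count-false (λ i → p (suc i)) (λ i → all-false (suc i))

count-≟ : ∀ {n} (g : Fin n) → count (λ b → does (b ≟ g)) ≡ 1
count-≟ {suc n} zero = cong suc (count-false {n} (λ b → does (suc b ≟ zero)) λ _ → refl)
count-≟ {suc n} (suc g) = count-≟ g

degree : ∀ {n} → Graph n → Fin n → ℕ
degree G x = count (adj G x)

degree-≅ : ∀ {n} {G H : Graph n} ((π , _) : G ≅ H) → ∀ x → degree G x ≡ degree H (π ⟨$⟩ʳ x)
degree-≅ {H = H} (π , e) x =
  trans (count-cong (e x)) (sym (∑-permute (λ y → boolToℕ (adj H (π ⟨$⟩ʳ x) y)) π))

-- In the glued graph below these are exactly the cone vertices (with d = h + 1).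
Rim : ∀ {n} → ℕ → Graph n → Fin n → Set
Rim d X x = degree X x ≤ d × (degree X x ≡ d ⊎ ∃ λ y → adj X x y ≡ true × degree X y ≡ d)

Rim-≅ : ∀ {n d} {X Y : Graph n} (iso@(π , _) : X ≅ Y) → ∀ {x} → Rim d X x → Rim d Y (π ⟨$⟩ʳ x)
Rim-≅ {d = d} {X} {Y} iso@(π , e) {x} (bounded , rim) =
  subst (_≤ d) (degree-preserved x) bounded , Sum.map (trans (sym (degree-preserved x))) neighbour rim
  where
  degree-preserved : ∀ x → degree X x ≡ degree Y (π ⟨$⟩ʳ x)
  degree-preserved = degree-≅ {G = X} {Y} iso
  neighbour : (∃ λ y → adj X x y ≡ true × degree X y ≡ d) → ∃ λ y → adj Y (π ⟨$⟩ʳ x) y ≡ true × degree Y y ≡ d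
  neighbour (y , x~y , degree≡) = π ⟨$⟩ʳ y , trans (sym (e x y)) x~y , trans (sym (degree-preserved y)) degree≡

-- Attaching a cone

≟-true⇒≡ : ∀ {n} {a b : Fin n} → does (a ≟ b) ≡ true → a ≡ b
≟-true⇒≡ {a = a} {b} e with a ≟ b
... | yes a≡b = a≡b
... | no _ = contradiction e λ ()

≟-refl : ∀ {n} (a : Fin n) → does (a ≟ a) ≡ true
≟-refl a = dec-true (a ≟ a) refl

module Glue {m} (G : Graph m) (g : Fin m) (h : ℕ) where

  ι : Fin m → Fin (m + suc h)
  ι a = a ↑ˡ suc h

  κ : Fin (suc h) → Fin (m + suc h)
  κ r = m ↑ʳ r

  glueAdj : Graph h → Fin m ⊎ Fin (suc h) → Fin m ⊎ Fin (suc h) → Bool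
  glueAdj H (inj₁ a) (inj₁ b) = adj G a b
  glueAdj H (inj₁ a) (inj₂ _) = does (a ≟ g)
  glueAdj H (inj₂ _) (inj₁ b) = does (b ≟ g)
  glueAdj H (inj₂ r) (inj₂ r′) = adj (cone H) r r′

  glueAdj-sym : ∀ H u v → glueAdj H u v ≡ glueAdj H v u
  glueAdj-sym H (inj₁ a) (inj₁ b) = adj-sym G a b
  glueAdj-sym H (inj₁ a) (inj₂ r) = refl
  glueAdj-sym H (inj₂ r) (inj₁ b) = refl
  glueAdj-sym H (inj₂ r) (inj₂ r′) = adj-sym (cone H) r r′

  glueAdj-irrefl : ∀ H u → glueAdj H u u ≡ false
  glueAdj-irrefl H (inj₁ a) = irrefl G a
  glueAdj-irrefl H (inj₂ r) = irrefl (cone H) r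

  glue : Graph h → Graph (m + suc h)
  glue H = record
    { adj = λ x y → glueAdj H (splitAt m x) (splitAt m y)
    ; adj-sym = λ x y → glueAdj-sym H (splitAt m x) (splitAt m y)
    ; irrefl = λ x → glueAdj-irrefl H (splitAt m x) }

  data View : Fin (m + suc h) → Set where
    inG : ∀ a → View (ι a)
    inCone : ∀ r → View (κ r)

  view : ∀ x → View x
  view x with splitAt m x | join-splitAt m (suc h) x
  ... | inj₁ a | refl = inG a
  ... | inj₂ r | refl = inCone r

  ι-split : ∀ a → splitAt m (ι a) ≡ inj₁ a
  ι-split a = splitAt-↑ˡ m a (suc h)

  κ-split : ∀ r → splitAt m (κ r) ≡ inj₂ r
  κ-split r = splitAt-↑ʳ m (suc h) r

  module _ (H : Graph h) where

    adj-ιι : ∀ a b → adj (glue H) (ι a) (ι b) ≡ adj G a b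
    adj-ιι a b rewrite ι-split a | ι-split b = refl

    adj-ικ : ∀ a r → adj (glue H) (ι a) (κ r) ≡ does (a ≟ g)
    adj-ικ a r rewrite ι-split a | κ-split r = refl

    adj-κι : ∀ r b → adj (glue H) (κ r) (ι b) ≡ does (b ≟ g)
    adj-κι r b rewrite κ-split r | ι-split b = refl

    adj-κκ : ∀ r r′ → adj (glue H) (κ r) (κ r′) ≡ adj (cone H) r r′
    adj-κκ r r′ rewrite κ-split r | κ-split r′ = refl

  collapse : Fin (m + suc h) → Fin m
  collapse x = [ id , const g ]′ (splitAt m x)

  collapse-ι : ∀ a → collapse (ι a) ≡ a
  collapse-ι a rewrite ι-split a = refl

  collapse-κ : ∀ r → collapse (κ r) ≡ g
  collapse-κ r rewrite κ-split r = refl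

  module _ (H : Graph h) where

    ι-step : ∀ {a b} → Step G a b → Step (glue H) (ι a) (ι b)
    ι-step (inj₁ a≡b) = inj₁ (cong ι a≡b)
    ι-step {a} {b} (inj₂ a~b) = inj₂ (trans (adj-ιι H a b) a~b)

    collapse-step : ∀ {x y} → Step (glue H) x y → Step G (collapse x) (collapse y)
    collapse-step (inj₁ x≡y) = inj₁ (cong collapse x≡y)
    collapse-step {x} {y} (inj₂ x~y) = edge (view x) (view y) x~y
      where
      edge : ∀ {x y} → View x → View y → adj (glue H) x y ≡ true → Step G (collapse x) (collapse y)
      edge (inG a) (inG b) a~b rewrite collapse-ι a | collapse-ι b = inj₂ (trans (sym (adj-ιι H a b)) a~b)
      edge (inG a) (inCone r) a~r rewrite collapse-ι a | collapse-κ r = inj₁ (≟-true⇒≡ (trans (sym (adj-ικ H a r)) a~r))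
      edge (inCone r) (inG b) r~b rewrite collapse-κ r | collapse-ι b =
        inj₁ (sym (≟-true⇒≡ (trans (sym (adj-κι H r b)) r~b)))
      edge (inCone r) (inCone r′) _ rewrite collapse-κ r | collapse-κ r′ = inj₁ refl

    glue-connected : Connected G → Connected (glue H)
    glue-connected (_ , G-connected) = ι g , λ x y → reach-trans (to-g x) (reach-sym (to-g y))
      where
      to-g : ∀ x → Reach (glue H) x (ι g)
      to-g x with view x
      ... | inG a = reach-map ι (λ a~b → ι-step (inj₂ a~b)) (G-connected a g)
      ... | inCone r = there (trans (adj-κι H r g) (≟-refl g)) here

    cone-guarded : ∀ {j} {c : Fin j → Fin m} {i} → c i ≡ g → ∀ r → Guarded (glue H) (λ i → ι (c i)) (κ r)
    cone-guarded {c = c} {i} cᵢ≡g r =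
      i , inj₂ (trans (adj-ικ H (c i) r) (subst (λ z → does (z ≟ g) ≡ true) (sym cᵢ≡g) (≟-refl g)))

    copsWin⇒glue : ∀ {j} → CopsWin G j → CopsWin (glue H) j
    copsWin⇒glue {j} = Simulation.transfer G (glue H) collapse (λ c i → ι (c i))
      (λ steps i → ι-step (steps i)) (λ _ _ step _ _ → collapse-step step) capture
      where
      capture : ∀ c x → Captured (c , collapse x) →
        Captured ((λ i → ι (c i)) , x) ⊎ Trapped (glue H) (λ i → ι (c i)) x
      capture c x (i , caught) with view x
      ... | inG a = inj₁ (i , cong ι (trans caught (collapse-ι a)))
      ... | inCone r = inj₂ (cone-guarded cᵢ≡g r , escape)
        where
        cᵢ≡g : c i ≡ g
        cᵢ≡g = trans caught (collapse-κ r)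
        escape : ∀ y → Step (glue H) (κ r) y → Captured ((λ i → ι (c i)) , y) ⊎ Guarded (glue H) (λ i → ι (c i)) y
        escape y (inj₁ refl) = inj₂ (cone-guarded cᵢ≡g r)
        escape y (inj₂ r~y) with view y
        ... | inG b = inj₁ (i , cong ι (trans cᵢ≡g (sym (≟-true⇒≡ (trans (sym (adj-κι H r b)) r~y)))))
        ... | inCone r′ = inj₂ (cone-guarded cᵢ≡g r′)

    glue⇒copsWin : ∀ {j} → CopsWin (glue H) j → CopsWin G j
    glue⇒copsWin = Simulation.transfer (glue H) G ι (λ c i → collapse (c i))
      (λ steps i → collapse-step (steps i)) (λ _ _ step _ _ → ι-step step)
      (λ c x (i , caught) → inj₁ (i , trans (cong collapse caught) (collapse-ι x)))

    glue-copNumber : ∀ {k} → CopNumber G k → CopNumber (glue H) k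
    glue-copNumber (win , minimal) = copsWin⇒glue win , λ j win′ → minimal j (glue⇒copsWin win′)

  coneIndex : Fin (m + suc h) → Fin (suc h)
  coneIndex x = [ const zero , id ]′ (splitAt m x)

  coneIndex-κ : ∀ r → coneIndex (κ r) ≡ r
  coneIndex-κ r rewrite κ-split r = refl

  module Recovery (m≤h : m ≤ h) {a₀} (g~a₀ : adj G g a₀ ≡ true) where

    module _ (H : Graph h) where

      degree-ι : ∀ a → degree (glue H) (ι a) ≡ degree G a + count (λ (_ : Fin (suc h)) → does (a ≟ g))
      degree-ι a = trans (count-split m (adj (glue H) (ι a))) (cong₂ _+_ (count-cong (adj-ιι H a)) (count-cong (adj-ικ H a)))

      degree-κ : ∀ r → degree (glue H) (κ r) ≡ 1 + degree (cone H) r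
      degree-κ r = trans (count-split m (adj (glue H) (κ r)))
        (cong₂ _+_ (trans (count-cong (adj-κι H r)) (count-≟ g)) (count-cong (adj-κκ H r)))

      degree-apex : degree (glue H) (κ zero) ≡ suc h
      degree-apex = trans (degree-κ zero) (cong suc (count-true (λ r → adj (cone H) zero (suc r)) λ _ → refl))

      degree-base : ∀ r → degree (glue H) (κ (suc r)) ≤ suc h
      degree-base r = subst (_≤ suc h) (sym (degree-κ (suc r))) (count-<-if-false (adj (cone H) (suc r)) (irrefl (cone H) (suc r)))

      degree-g : suc (suc h) ≤ degree (glue H) (ι g)
      degree-g = subst (suc (suc h) ≤_) (sym (degree-ι g))
        (+-mono-≤ (count-≥1-if-true (adj G g) g~a₀)
                  (≤-reflexive (sym (count-true {suc h} (λ _ → does (g ≟ g)) λ _ → ≟-refl g))))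

      degree-ι-other : ∀ {a} → a ≢ g → degree (glue H) (ι a) ≤ h
      degree-ι-other {a} a≢g = subst (_≤ h) (sym (trans (degree-ι a) no-cone-neighbours)) (≤-trans (count-≤ (adj G a)) m≤h)
        where
        no-cone-neighbours : degree G a + count (λ (_ : Fin (suc h)) → does (a ≟ g)) ≡ degree G a
        no-cone-neighbours = trans
          (cong (degree G a +_) (count-false {suc h} (λ _ → does (a ≟ g)) λ _ → dec-false (a ≟ g) a≢g))
          (+-identityʳ _)

      degree-ι≢ : ∀ a → degree (glue H) (ι a) ≢ suc h
      degree-ι≢ a degree≡ with a ≟ g
      ... | yes refl = 1+n≰n (subst (suc (suc h) ≤_) degree≡ degree-g)
      ... | no a≢g = 1+n≰n (subst (_≤ h) degree≡ (degree-ι-other a≢g))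

      cone-Rim : ∀ r → Rim (suc h) (glue H) (κ r)
      cone-Rim zero = ≤-reflexive degree-apex , inj₁ degree-apex
      cone-Rim (suc r) = degree-base r , inj₂ (κ zero , adj-κκ H (suc r) zero , degree-apex)

      ι-¬Rim : ∀ a → ¬ Rim (suc h) (glue H) (ι a)
      ι-¬Rim a (bounded , rim) with a ≟ g
      ... | yes refl = 1+n≰n (≤-trans degree-g bounded)
      ... | no a≢g = [ degree-ι≢ a , no-rim-neighbour ] rim
        where
        no-rim-neighbour : ¬ ∃ λ y → adj (glue H) (ι a) y ≡ true × degree (glue H) y ≡ suc h
        no-rim-neighbour (y , a~y , degree≡) = neighbour (view y) a~y degree≡
          where
          neighbour : ∀ {y} → View y → adj (glue H) (ι a) y ≡ true → degree (glue H) y ≢ suc h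
          neighbour (inG b) _ = degree-ι≢ b
          neighbour (inCone r) a~r _ = a≢g (≟-true⇒≡ (trans (sym (adj-ικ H a r)) a~r))

      Rim⇒cone : ∀ {x} → Rim (suc h) (glue H) x → x ≡ κ (coneIndex x)
      Rim⇒cone {x} = go (view x)
        where
        go : ∀ {x} → View x → Rim (suc h) (glue H) x → x ≡ κ (coneIndex x)
        go (inG a) rim = ⊥-elim (ι-¬Rim a rim)
        go (inCone r) _ = cong κ (sym (coneIndex-κ r))

    glue-reflects-≅ : ∀ H H′ → glue H ≅ glue H′ → H ≅ H′
    glue-reflects-≅ H H′ iso@(π , e) = cone-reflects-≅ H H′ (restriction , restriction-preserves)
      where
      to from : Fin (suc h) → Fin (suc h)
      to r = coneIndex (π ⟨$⟩ʳ κ r)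
      from r = coneIndex (π ⟨$⟩ˡ κ r)
      π-κ : ∀ r → π ⟨$⟩ʳ κ r ≡ κ (to r)
      π-κ r = Rim⇒cone H′ (Rim-≅ {X = glue H} {glue H′} iso (cone-Rim H r))
      π⁻¹-κ : ∀ r → π ⟨$⟩ˡ κ r ≡ κ (from r)
      π⁻¹-κ r = Rim⇒cone H (Rim-≅ {X = glue H′} {glue H} (≅-sym {G = glue H} {glue H′} iso) (cone-Rim H′ r))
      to-from : ∀ r → to (from r) ≡ r
      to-from r =
        trans (cong (λ z → coneIndex (π ⟨$⟩ʳ z)) (sym (π⁻¹-κ r))) (trans (cong coneIndex (inverseʳ π)) (coneIndex-κ r))
      from-to : ∀ r → from (to r) ≡ r
      from-to r =
        trans (cong (λ z → coneIndex (π ⟨$⟩ˡ z)) (sym (π-κ r))) (trans (cong coneIndex (inverseˡ π)) (coneIndex-κ r))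
      restriction : Permutation (suc h) (suc h)
      restriction = mk↔ₛ′ to from to-from from-to
      restriction-preserves : ∀ i j → adj (cone H) i j ≡ adj (cone H′) (to i) (to j)
      restriction-preserves i j = begin
        adj (cone H) i j                    ≡⟨ adj-κκ H i j ⟨
        adj (glue H) (κ i) (κ j)            ≡⟨ e (κ i) (κ j) ⟩
        adj (glue H′) (π ⟨$⟩ʳ κ i) (π ⟨$⟩ʳ κ j) ≡⟨ cong₂ (adj (glue H′)) (π-κ i) (π-κ j) ⟩
        adj (glue H′) (κ (to i)) (κ (to j)) ≡⟨ adj-κκ H′ (to i) (to j) ⟩
        adj (cone H′) (to i) (to j)         ∎
        where open ≡-Reasoning

-- Vertex deletion and graphs of minimum order

delete : ∀ {m} → Graph (suc m) → Fin (suc m) → Graph m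
delete G v = record
  { adj = λ i j → adj G (punchIn v i) (punchIn v j)
  ; adj-sym = λ i j → adj-sym G (punchIn v i) (punchIn v j)
  ; irrefl = λ i → irrefl G (punchIn v i) }

copsWin-delete : ∀ {m} (G : Graph (2+ m)) v {j} → CopsWin (delete G v) j → CopsWin G (suc j)
copsWin-delete G v {j} = Simulation.transfer (delete G v) G project guardV
  (λ steps → λ { zero → inj₁ refl ; (suc i) → Sum.map (cong (punchIn v)) id (steps i) })
  evade
  (λ c x (i , caught) → inj₁ (capture c x i caught))
  where
  -- The value at v is arbitrary: a robber on v has already been caught by cop zero.
  project : Fin (2+ _) → Fin (suc _)
  project x with v ≟ x
  ... | yes _ = zero
  ... | no v≢x = punchOut v≢x
  project-sound : ∀ {x} → x ≢ v → punchIn v (project x) ≡ x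
  project-sound {x} x≢v with v ≟ x
  ... | yes v≡x = ⊥-elim (x≢v (sym v≡x))
  ... | no v≢x = punchIn-punchOut v≢x
  guardV : (Fin j → Fin (suc _)) → Fin (suc j) → Fin (2+ _)
  guardV c zero = v
  guardV c (suc i) = punchIn v (c i)
  avoids-v : ∀ c {x} → ¬ Captured (guardV c , x) → x ≢ v
  avoids-v c uncaught x≡v = uncaught (zero , sym x≡v)
  evade : ∀ c c′ {x y} → Step G x y → ¬ Captured (guardV c , x) → ¬ Captured (guardV c′ , y) →
    Step (delete G v) (project x) (project y)
  evade c c′ (inj₁ x≡y) _ _ = inj₁ (cong project x≡y)
  evade c c′ (inj₂ x~y) x-free y-free =
    inj₂ (trans (cong₂ (adj G) (project-sound (avoids-v c x-free)) (project-sound (avoids-v c′ y-free))) x~y)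
  capture : ∀ c x i → c i ≡ project x → Captured (guardV c , x)
  capture c x i caught with x ≟ v
  ... | yes x≡v = zero , sym x≡v
  ... | no x≢v = suc i , trans (cong (punchIn v) caught) (project-sound x≢v)

module Distance {n} (G : Graph n) (r : Fin n) (reaches : ∀ u → Reach G u r) where

  data Within : ℕ → Fin n → Set where
    at-root : ∀ {t} → Within t r
    via : ∀ {t u w} → adj G u w ≡ true → Within t w → Within (suc t) u

  within? : ∀ u → Decidable (λ t → Within t u)
  within? u t with u ≟ r
  ... | yes refl = yes at-root
  within? u zero | no u≢r = no λ { at-root → u≢r refl }
  within? u (suc t) | no u≢r with any? (λ w → (adj G u w Bool.≟ true) ×-dec within? w t)
  ... | yes (w , u~w , w-within) = yes (via u~w w-within)
  ... | no ¬step = no λ { at-root → u≢r refl ; (via u~w w-within) → ¬step (_ , u~w , w-within) }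

  reach⇒within : ∀ {u} → Reach G u r → ∃ λ t → Within t u
  reach⇒within here = 0 , at-root
  reach⇒within (there u~w path) = let (t , w-within) = reach⇒within path in suc t , via u~w w-within

  opaque
    shortest : ∀ u → ∃ (Least (λ t → Within t u))
    shortest u = least (within? u) (proj₂ (reach⇒within (reaches u)))

    dist : Fin n → ℕ
    dist u = proj₁ (shortest u)

    dist-least : ∀ u {t} → Within t u → dist u ≤ t
    dist-least u = proj₂ (proj₂ (shortest u)) _

    dist-root : dist r ≡ 0
    dist-root = n≤0⇒n≡0 (dist-least r at-root)

    dist-zero : ∀ {u} → dist u ≡ 0 → u ≡ r
    dist-zero {u} dist≡0 = root (subst (λ t → Within t u) dist≡0 (proj₁ (proj₂ (shortest u))))
      where
      root : Within 0 u → u ≡ r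
      root at-root = refl

    closer-neighbour : ∀ {u} → u ≢ r → ∃ λ w → adj G u w ≡ true × dist w < dist u
    closer-neighbour {u} u≢r = step u≢r (proj₁ (proj₂ (shortest u)))
      where
      step : ∀ {t u} → u ≢ r → Within t u → ∃ λ w → adj G u w ≡ true × dist w < t
      step r≢r at-root = ⊥-elim (r≢r refl)
      step _ (via u~w w-within) = _ , u~w , s≤s (dist-least _ w-within)

argmax-Fin : ∀ {n} (f : Fin (suc n) → ℕ) → ∃ λ v → ∀ u → f u ≤ f v
argmax-Fin f = argmax f zero (allFin _) , λ u → All.lookup (f[xs]≤f[argmax] {f = f} zero (allFin _)) (∈-allFin u)

-- A vertex farthest from r is not a cut vertex: from any other vertex, repeatedly stepping to a
-- neighbour closer to r reaches r without passing through it.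
module FarthestVertex {m} (G : Graph (2+ m)) (r : Fin (2+ m)) (reaches : ∀ u → Reach G u r)
  (v : Fin (2+ m)) (farthest : ∀ u → Distance.dist G r reaches u ≤ Distance.dist G r reaches v) where
  open Distance G r reaches

  v≢r : v ≢ r
  v≢r v≡r = punchInᵢ≢i r zero
    (dist-zero (n≤0⇒n≡0 (≤-trans (farthest _) (≤-reflexive (trans (cong dist v≡r) dist-root)))))

  r′ : Fin (suc m)
  r′ = punchOut v≢r

  to-root : ∀ a → Reach (delete G v) a r′
  to-root a = descend (suc (dist (punchIn v a))) a ≤-refl
    where
    descend : ∀ fuel a → dist (punchIn v a) < fuel → Reach (delete G v) a r′
    descend (suc fuel) a (s≤s dist≤fuel) with punchIn v a ≟ r
    ... | yes a-root = subst (λ z → Reach (delete G v) z r′)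
            (punchIn-injective v r′ a (trans (punchIn-punchOut v≢r) (sym a-root))) here
    ... | no a-not-root with closer-neighbour a-not-root
    ...   | w , a~w , w-closer = there a~b (descend fuel b (<-≤-trans b-closer dist≤fuel))
      where
      v≢w : v ≢ w
      v≢w v≡w = <-irrefl refl
        (<-≤-trans (subst (λ z → dist z < dist (punchIn v a)) (sym v≡w) w-closer) (farthest (punchIn v a)))
      b : Fin (suc m)
      b = punchOut v≢w
      a~b : adj (delete G v) a b ≡ true
      a~b = trans (cong (adj G (punchIn v a)) (punchIn-punchOut v≢w)) a~w
      b-closer : dist (punchIn v b) < dist (punchIn v a)
      b-closer = subst (λ z → dist z < dist (punchIn v a)) (sym (punchIn-punchOut v≢w)) w-closer

  delete-connected : Connected (delete G v)
  delete-connected = r′ , λ a b → reach-trans (to-root a) (reach-sym (to-root b))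

nonCutVertex : ∀ {m} (G : Graph (2+ m)) → Connected G → ∃ λ v → Connected (delete G v)
nonCutVertex {m} G (r , G-connected) = v , FarthestVertex.delete-connected G r reaches v farthest
  where
  reaches : ∀ u → Reach G u r
  reaches u = G-connected u r
  open Distance G r reaches using (dist)
  v : Fin (2+ m)
  v = proj₁ (argmax-Fin dist)
  farthest : ∀ u → dist u ≤ dist v
  farthest = proj₂ (argmax-Fin dist)

another : ∀ {m} → 2 ≤ m → (x : Fin m) → ∃ λ y → y ≢ x
another {suc zero} (s≤s ()) _
another {2+ m} _ x = punchIn x zero , punchInᵢ≢i x zero

connected⇒neighbour : ∀ {m} (G : Graph m) → 2 ≤ m → Connected G → ∀ g → ∃ λ a → adj G g a ≡ true
connected⇒neighbour G 2≤m (_ , G-connected) g with another 2≤m g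
... | y , y≢g = first-edge (G-connected g y) (≢-sym y≢g)
  where
  first-edge : ∀ {u v} → Reach G u v → u ≢ v → ∃ λ a → adj G u a ≡ true
  first-edge here u≢u = ⊥-elim (u≢u refl)
  first-edge (there u~a _) _ = _ , u~a

minOrder-≥2 : ∀ {k m} → 1 < k → IsMinOrder k m → 2 ≤ m
minOrder-≥2 {m = zero} _ ((_ , (() , _) , _) , _)
minOrder-≥2 {m = suc zero} 1<k ((G , _ , c , (_ , c-least) , k≤c) , _) =
  ⊥-elim (1+n≰n (≤-trans 1<k (≤-trans k≤c (c-least 1 (copOnEveryVertex-win G)))))
minOrder-≥2 {m = 2+ m} _ _ = s≤s (s≤s z≤n)

-- Deleting a non-cut vertex v leaves a connected graph of smaller order, so c(G − v) < k by
-- minimality, and c(G) ≤ c(G − v) + 1.  The cop number c(G − v) exists only classically, but the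
-- conclusion c ≤ k is decidable.
minOrder-copNumber≤ : ∀ {k m c} (G : Graph (2+ m)) → Connected G → (∀ j → CopsWin G j → c ≤ j) →
  (∀ m′ (H : Graph m′) → Connected H → CopNumber≥ H k → 2+ m ≤ m′) → c ≤ k
minOrder-copNumber≤ {k} {m} {c} G G-connected c-least minimal = decidable-stable (c ≤? k) ¬¬c≤k
  where
  v : Fin (2+ m)
  v = proj₁ (nonCutVertex G G-connected)
  bound : ∃ (Least (CopsWin (delete G v))) → c ≤ k
  bound (c′ , c′-wins , c′-least) = ≤-trans (c-least (suc c′) (copsWin-delete G v c′-wins)) (≰⇒> k≰c′)
    where
    k≰c′ : ¬ k ≤ c′
    k≰c′ k≤c′ =
      1+n≰n (minimal (suc m) (delete G v) (proj₂ (nonCutVertex G G-connected)) (c′ , (c′-wins , c′-least) , k≤c′))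
  ¬¬c≤k : ¬ ¬ c ≤ k
  ¬¬c≤k c≰k = ¬¬-least (copOnEveryVertex-win (delete G v)) λ least → c≰k (bound least)

minOrder-copNumber : ∀ {k m} → 1 < k → (M : IsMinOrder k m) → CopNumber (proj₁ (proj₁ M)) k
minOrder-copNumber {k} {m} 1<k M@((G , G-connected , c , (c-wins , c-least) , k≤c) , minimal) =
  subst (CopsWin G) (≤-antisym (c≤k (minOrder-≥2 1<k M)) k≤c) c-wins , λ j wins → ≤-trans k≤c (c-least j wins)
  where
  c≤k : 2 ≤ m → c ≤ k
  c≤k (s≤s (s≤s _)) = minOrder-copNumber≤ G G-connected c-least minimal

-- Counting

split-order : ∀ {m n} → 2 * m < n → ∃ λ h → m ≤ h × m + suc h ≡ n
split-order {m} 2m<n with m≤n⇒∃[o]m+o≡n 2m<n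
... | e , refl = m + e , m≤m+n m e , (begin
  m + suc (m + e)  ≡⟨ +-suc m (m + e) ⟩
  suc (m + (m + e)) ≡⟨ cong suc (+-assoc m m e) ⟨
  suc (m + m + e)   ≡⟨ cong (λ z → suc (m + z + e)) (+-identityʳ m) ⟨
  suc (2 * m + e)   ∎)
  where open ≡-Reasoning

glue-count-≤ : ∀ {m k} (G : Graph m) → 2 ≤ m → Connected G → CopNumber G k → ∀ {h a b} → m ≤ h →
  IsoClassCount h (λ _ → ⊤) a → IsoClassCount (m + suc h) (λ X → Connected X × CopNumber X k) b → a ≤ b
glue-count-≤ {m} {k} G 2≤m G-connected G-cop {h} m≤h =
  isoClassCount-≤ {P = λ X → Connected X × CopNumber X k} glue (λ H → glue-connected H G-connected , glue-copNumber H G-cop)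
    (Recovery.glue-reflects-≅ m≤h (proj₂ (connected⇒neighbour G 2≤m G-connected g)))
  where
  g : Fin m
  g = proj₁ G-connected
  open Glue G g h

minOrder-count-≤ : ∀ {k m} → 1 < k → IsMinOrder k m → ∀ {n} → 2 * m < n → ∀ {a b} →
  IsoClassCount (n ∸ m ∸ 1) (λ _ → ⊤) a → IsoClassCount n (λ G → Connected G × CopNumber G k) b → a ≤ b
minOrder-count-≤ {m = m} 1<k M@((G , G-connected , _) , _) 2m<n with split-order {m} 2m<n
... | h , m≤h , refl rewrite m+n∸m≡n m (suc h) =
  glue-count-≤ G (minOrder-≥2 1<k M) G-connected (minOrder-copNumber 1<k M) m≤h

theorem4 :
    (∀ n → 1 < n → ∀ a b →
      IsoClassCount (n ∸ 1) (λ _ → ⊤) a →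
      IsoClassCount n (λ G → Connected G × CopNumber G 1) b →
      a ≤ b)
    ×
    (∀ k → 1 < k → ∀ m → IsMinOrder k m → ∀ n → 2 * m < n → ∀ a b →
      IsoClassCount (n ∸ m ∸ 1) (λ _ → ⊤) a →
      IsoClassCount n (λ G → Connected G × CopNumber G k) b →
      a ≤ b)
theorem4 =
  (λ { (suc h) _ _ _ → isoClassCount-≤ cone (λ H → cone-connected H , cone-copNumber H) cone-reflects-≅ }) ,
  λ k 1<k m M n 2m<n _ _ → minOrder-count-≤ 1<k M 2m<n
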